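{- Let $S_{1,n}$ be a star graph (one central vertex adjacent to $n\ge 1$ leaves). For any graph $H$, $$\gamma_o(S_{1,n}\Box H)\ge \gamma_o(S_{1,n})\gamma_o(H).$$
   Context: All graphs are finite and simple. For a graph with vertex set $V$, a vertex $v$ and $S\subseteq V$, let $\delta_S(v)=|N(v)\cap S|$ and $\overline{S}=V\setminus S$. A nonempty set $S\subseteq V$ is a global offensive alliance if $\delta_S(v)\ge \delta_{\overline{S}}(v)+1$ for every $v\in\overline{S}$; $\gamma_o(G)$ is the minimum cardinality of a global offensive alliance of $G$. $G\Box H$ is the Cartesian product: vertex set $V(G)\times V(H)$, with $(a,b)\sim(c,d)$ iff ($a=c$ and $b\sim d$ in $H$) or ($a\sim c$ in $G$ and $b=d$). -}

module Defs where

open import Data.Nat using (ℕ; zero; suc; _+_; _*_; _≤_; _<_)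
open import Data.Bool using (Bool; true; false; _∧_; _∨_; if_then_else_)
open import Data.Fin using (Fin; zero; suc; remQuot)
open import Data.Fin.Subset using (Subset; _∈_; _∉_; ∣_∣; Nonempty)
open import Data.Fin.Subset.Properties using (_∈?_)
open import Data.Fin.Properties using (_≟_)
open import Data.Product using (_×_; _,_; proj₁; proj₂; ∃)
open import Relation.Binary.PropositionalEquality using (_≡_)
open import Relation.Nullary using (¬_; Dec; does)

record Graph : Set where
  field
    n     : ℕ
    adj   : Fin n → Fin n → Bool
    sym   : ∀ u v → adj u v ≡ adj v u
    irref : ∀ v → adj v v ≡ false

open Graph public

count : ∀ {m} {P : Fin m → Set} → (∀ u → Dec (P u)) → ℕ
count {zero} d = 0
count {suc m} d = (if does (d zero) then 1 else 0) + count (λ u → d (suc u))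

δ : (G : Graph) → Subset (n G) → Fin (n G) → ℕ
δ G S v = count {P = λ u → adj G v u ≡ true × u ∈ S}
  (λ u → Data.Bool._≟_ (adj G v u) true Relation.Nullary.×-dec (u ∈? S)) 
  where import Data.Bool
        import Relation.Nullary

δc : (G : Graph) → Subset (n G) → Fin (n G) → ℕ
δc G S v = count {P = λ u → adj G v u ≡ true × u ∉ S}
  (λ u → Data.Bool._≟_ (adj G v u) true Relation.Nullary.×-dec Relation.Nullary.¬? (u ∈? S))
  where import Data.Bool
        import Relation.Nullary

IsGOA : (G : Graph) → Subset (n G) → Set
IsGOA G S = Nonempty S × (∀ v → v ∉ S → δc G S v + 1 ≤ δ G S v)

IsGammaO : Graph → ℕ → Set
IsGammaO G k = (∃ λ S → IsGOA G S × ∣ S ∣ ≡ k) × (∀ S → IsGOA G S → k ≤ ∣ S ∣)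

-- Star S_{1,n}: vertex 0 is the centre, vertices 1..n are leaves.
starAdj : ∀ {m} → Fin m → Fin m → Bool
starAdj zero    zero    = false
starAdj zero    (suc _) = true
starAdj (suc _) zero    = true
starAdj (suc _) (suc _) = false

star : ℕ → Graph
star k = record { n = suc k ; adj = starAdj ; sym = s ; irref = i }
  where
  s : ∀ (u v : Fin (suc k)) → starAdj u v ≡ starAdj v u
  s zero zero = Relation.Binary.PropositionalEquality.refl
  s zero (suc _) = Relation.Binary.PropositionalEquality.refl
  s (suc _) zero = Relation.Binary.PropositionalEquality.refl
  s (suc _) (suc _) = Relation.Binary.PropositionalEquality.refl
  i : ∀ (v : Fin (suc k)) → starAdj v v ≡ false
  i zero = Relation.Binary.PropositionalEquality.refl
  i (suc _) = Relation.Binary.PropositionalEquality.refl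

-- Cartesian product G □ H on Fin (n G * n H), vertex (a,b) encoded by combine a b.
-- (a,b) ~ (c,d) iff (a = c and b ~ d) or (a ~ c and b = d)
boxAdj' : (G H : Graph) → Fin (n G) × Fin (n H) → Fin (n G) × Fin (n H) → Bool
boxAdj' G H (a , b) (c , d) = (does (a ≟ c) ∧ adj H b d) ∨ (adj G a c ∧ does (b ≟ d))

boxAdj : (G H : Graph) → Fin (n G * n H) → Fin (n G * n H) → Bool
boxAdj G H x y = boxAdj' G H (remQuot (n H) x) (remQuot (n H) y)

_□_ : Graph → Graph → Graph
G □ H = record { n = n G * n H ; adj = boxAdj G H ; sym = s ; irref = i }
  where
  open import Data.Bool.Properties using (∨-comm)
  open import Relation.Binary.PropositionalEquality using (refl; cong₂; cong)
  eqsym : ∀ {k} (a c : Fin k) → does (a ≟ c) ≡ does (c ≟ a)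
  eqsym a c with a ≟ c | c ≟ a
  ... | Relation.Nullary.yes _ | Relation.Nullary.yes _ = refl
  ... | Relation.Nullary.no _ | Relation.Nullary.no _ = refl
  ... | Relation.Nullary.yes p | Relation.Nullary.no q = Data.Empty.⊥-elim (q (Relation.Binary.PropositionalEquality.sym p))
    where import Data.Empty
  ... | Relation.Nullary.no q | Relation.Nullary.yes p = Data.Empty.⊥-elim (q (Relation.Binary.PropositionalEquality.sym p))
    where import Data.Empty
  s' : ∀ p q → boxAdj' G H p q ≡ boxAdj' G H q p
  s' (a , b) (c , d) =
    cong₂ _∨_ (cong₂ _∧_ (eqsym a c) (Graph.sym H b d))
              (cong₂ _∧_ (Graph.sym G a c) (eqsym b d))
  s : ∀ x y → boxAdj G H x y ≡ boxAdj G H y x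
  s x y = s' (remQuot (n H) x) (remQuot (n H) y)
  i : ∀ x → boxAdj G H x x ≡ false
  i x = i' (remQuot (n H) x)
    where
    import Data.Bool.Properties
    i' : ∀ p → boxAdj' G H p p ≡ false
    i' (a , b) rewrite irref H b | irref G a
        | Data.Bool.Properties.∧-zeroʳ (does (a ≟ a)) = refl

-- The projection of an offensive alliance T of G □ H onto H is an offensive
-- alliance of H of size at most |T|: a vertex h outside the projection has, in
-- every G-layer x, a copy (x , h) outside T all of whose T-neighbours lie in its
-- own H-layer, so the alliance condition at (x , h) transfers to h.  Hence
-- γ_o(H) ≤ γ_o(G □ H) for every G, and the centre of a star alone is an offensive
-- alliance, so γ_o(S_{1,n}) ≤ 1.
module Submission where

open import Defs hiding (sym)
open import Data.Nat using (ℕ; zero; suc; _+_; _*_; _≤_; _≥_; z≤n; s≤s)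
open import Data.Nat.Properties
  using (≤-trans; ≤-antisym; ≤-reflexive; m≤m+n; m≤n+m; m≤n⇒m≤1+n; n≤1+n;
         +-suc; +-assoc; +-identityʳ; +-monoˡ-≤; +-monoʳ-≤; *-monoˡ-≤; *-identityˡ;
         module ≤-Reasoning)
open import Data.Bool using (true; false; _∧_; _∨_; if_then_else_)
import Data.Bool
open import Data.Bool.Properties using (∨-identityʳ)
open import Data.Fin using (Fin; zero; suc; _↑ˡ_; _↑ʳ_; combine; remQuot)
open import Data.Fin.Properties
  using (_≟_; any?; 0≢1+n; suc-injective; remQuot-combine; combine-remQuot)
open import Data.Fin.Subset using (Subset; _∈_; _∉_; ∣_∣; ⁅_⁆)
open import Data.Fin.Subset.Properties using (_∈?_; drop-there; x∈⁅x⁆; ∣⁅x⁆∣≡1)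
open import Data.Vec using (_∷_; []; tabulate; there)
open import Data.Vec.Properties using (lookup∘tabulate; []=⇒lookup; lookup⇒[]=)
open import Data.Product using (_×_; _,_; proj₁; proj₂; ∃)
open import Data.Sum using (_⊎_; inj₁; inj₂)
open import Data.Empty using (⊥-elim)
open import Function using (_∘_)
open import Relation.Nullary using (Dec; yes; no; does; ¬_; _×-dec_; _⊎-dec_; ¬?)
open import Relation.Nullary.Decidable using (dec-true)
open import Relation.Binary.PropositionalEquality
  using (_≡_; refl; sym; trans; cong; cong₂; subst; module ≡-Reasoning)

does-true⇒ : ∀ {A : Set} (A? : Dec A) → does A? ≡ true → A
does-true⇒ (yes a) _ = a

count-mono : ∀ {k} {P Q : Fin k → Set} (P? : ∀ u → Dec (P u)) (Q? : ∀ u → Dec (Q u)) →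
  (∀ u → P u → Q u) → count P? ≤ count Q?
count-mono {zero}  P? Q? P⇒Q = z≤n
count-mono {suc k} P? Q? P⇒Q with P? zero | Q? zero
... | yes _ | yes _  = s≤s (count-mono (P? ∘ suc) (Q? ∘ suc) (P⇒Q ∘ suc))
... | yes p | no ¬q  = ⊥-elim (¬q (P⇒Q zero p))
... | no _  | yes _  = m≤n⇒m≤1+n (count-mono (P? ∘ suc) (Q? ∘ suc) (P⇒Q ∘ suc))
... | no _  | no _   = count-mono (P? ∘ suc) (Q? ∘ suc) (P⇒Q ∘ suc)

count-cong : ∀ {k} {P Q : Fin k → Set} (P? : ∀ u → Dec (P u)) (Q? : ∀ u → Dec (Q u)) →
  (∀ u → P u → Q u) → (∀ u → Q u → P u) → count P? ≡ count Q?
count-cong P? Q? P⇒Q Q⇒P = ≤-antisym (count-mono P? Q? P⇒Q) (count-mono Q? P? Q⇒P)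

count-none : ∀ {k} {P : Fin k → Set} (P? : ∀ u → Dec (P u)) →
  (∀ u → ¬ P u) → count P? ≡ 0
count-none {zero}  P? ¬P = refl
count-none {suc k} P? ¬P with P? zero
... | yes p = ⊥-elim (¬P zero p)
... | no _  = count-none (P? ∘ suc) (¬P ∘ suc)

count-⊎ : ∀ {k} {P Q : Fin k → Set} (P? : ∀ u → Dec (P u)) (Q? : ∀ u → Dec (Q u)) →
  count (λ u → P? u ⊎-dec Q? u) ≤ count P? + count Q?
count-⊎ {zero}  P? Q? = z≤n
count-⊎ {suc k} P? Q? with P? zero | Q? zero
... | yes _ | yes _ = s≤s (≤-trans (count-⊎ (P? ∘ suc) (Q? ∘ suc))
                                   (+-monoʳ-≤ (count (P? ∘ suc)) (n≤1+n _)))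
... | yes _ | no _  = s≤s (count-⊎ (P? ∘ suc) (Q? ∘ suc))
... | no _  | yes _ = ≤-trans (s≤s (count-⊎ (P? ∘ suc) (Q? ∘ suc)))
                              (≤-reflexive (sym (+-suc (count (P? ∘ suc)) _)))
... | no _  | no _  = count-⊎ (P? ∘ suc) (Q? ∘ suc)

count-+ : ∀ a {b} {P : Fin (a + b) → Set} (P? : ∀ u → Dec (P u)) →
  count P? ≡ count (λ u → P? (u ↑ˡ b)) + count (λ u → P? (a ↑ʳ u))
count-+ zero P? = refl
count-+ (suc a) P? =
  trans (cong ((if does (P? zero) then 1 else 0) +_) (count-+ a (λ u → P? (suc u))))
        (sym (+-assoc (if does (P? zero) then 1 else 0) _ _))

count-layer≤ : ∀ {k N} {P : Fin (k * N) → Set} (P? : ∀ u → Dec (P u)) (x : Fin k) →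
  count (λ h → P? (combine {k} {N} x h)) ≤ count P?
count-layer≤ {suc k} {N} P? zero =
  ≤-trans (m≤m+n _ _) (≤-reflexive (sym (count-+ N P?)))
count-layer≤ {suc k} {N} P? (suc x) =
  ≤-trans (count-layer≤ {k} {N} (λ j → P? (N ↑ʳ j)) x)
          (≤-trans (m≤n+m _ _) (≤-reflexive (sym (count-+ N P?))))

count-off-layers : ∀ {k N} {P : Fin (k * N) → Set} (P? : ∀ u → Dec (P u)) →
  (∀ x h → ¬ P (combine {k} {N} x h)) → count P? ≡ 0
count-off-layers {zero} P? ¬P = refl
count-off-layers {suc k} {N} P? ¬P =
  trans (count-+ N P?)
        (cong₂ _+_ (count-none _ (¬P zero))
                   (count-off-layers {k} {N} (λ j → P? (N ↑ʳ j)) (λ x → ¬P (suc x))))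

count-within-layer : ∀ {k N} {P : Fin (k * N) → Set} (P? : ∀ u → Dec (P u)) (x : Fin k) →
  (∀ y h → P (combine {k} {N} y h) → y ≡ x) →
  count P? ≤ count (λ h → P? (combine {k} {N} x h))
count-within-layer {suc k} {N} P? zero onlyIn = ≤-reflexive (begin
  count P?
    ≡⟨ count-+ N P? ⟩
  count layer₀ + count rest
    ≡⟨ cong (count layer₀ +_)
            (count-off-layers {k} {N} rest (λ y h p → 0≢1+n (sym (onlyIn (suc y) h p)))) ⟩
  count layer₀ + 0
    ≡⟨ +-identityʳ _ ⟩
  count layer₀ ∎)
  where
  open ≡-Reasoning
  layer₀ = λ h → P? (combine {suc k} {N} zero h)
  rest = λ j → P? (N ↑ʳ j)
count-within-layer {suc k} {N} P? (suc x) onlyIn = begin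
  count P?
    ≡⟨ count-+ N P? ⟩
  count layer₀ + count rest
    ≡⟨ cong (_+ count rest) (count-none layer₀ (λ h p → 0≢1+n (onlyIn zero h p))) ⟩
  count rest
    ≤⟨ count-within-layer {k} {N} rest x (λ y h p → suc-injective (onlyIn (suc y) h p)) ⟩
  count (λ h → P? (combine {suc k} {N} (suc x) h)) ∎
  where
  open ≤-Reasoning
  layer₀ = λ h → P? (combine {suc k} {N} zero h)
  rest = λ j → P? (N ↑ʳ j)

count-∃-layer≤ : ∀ {k N} {P : Fin (k * N) → Set} (P? : ∀ u → Dec (P u)) →
  count (λ h → any? (λ x → P? (combine {k} {N} x h))) ≤ count P?
count-∃-layer≤ {zero} {N} P? = ≤-reflexive (count-none {N} _ (λ { h (() , _) }))
count-∃-layer≤ {suc k} {N} {P} P? = begin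
  count (λ h → any? (λ x → P? (combine {suc k} {N} x h)))
    ≤⟨ count-mono _ (λ h → here? h ⊎-dec there? h)
         (λ h → λ { (zero , p) → inj₁ p ; (suc x , p) → inj₂ (x , p) }) ⟩
  count (λ h → here? h ⊎-dec there? h)
    ≤⟨ count-⊎ here? there? ⟩
  count here? + count there?
    ≤⟨ +-monoʳ-≤ (count here?) (count-∃-layer≤ {k} {N} (λ j → P? (N ↑ʳ j))) ⟩
  count here? + count (λ j → P? (N ↑ʳ j))
    ≡⟨ sym (count-+ N P?) ⟩
  count P? ∎
  where
  open ≤-Reasoning
  here? : ∀ h → Dec (P (combine {suc k} {N} zero h))
  here? h = P? (combine {suc k} {N} zero h)
  there? : ∀ h → Dec (∃ λ x → P (N ↑ʳ combine {k} {N} x h))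
  there? h = any? (λ x → P? (N ↑ʳ combine {k} {N} x h))

count-∈-∷ : ∀ {k} s (S : Subset k) → count (_∈? S) ≡ count (λ u → suc u ∈? s ∷ S)
count-∈-∷ s S =
  count-cong (_∈? S) (λ u → suc u ∈? s ∷ S) (λ _ → there) (λ _ → drop-there)

∣S∣≡count-∈ : ∀ {k} (S : Subset k) → ∣ S ∣ ≡ count (_∈? S)
∣S∣≡count-∈ []          = refl
∣S∣≡count-∈ (true ∷ S)  = cong suc (trans (∣S∣≡count-∈ S) (count-∈-∷ true S))
∣S∣≡count-∈ (false ∷ S) = trans (∣S∣≡count-∈ S) (count-∈-∷ false S)

projection₂ : ∀ {k N} → Subset (k * N) → Subset N
projection₂ {k} {N} T = tabulate (λ h → does (any? (λ x → combine {k} {N} x h ∈? T)))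

module _ {k N : ℕ} {T : Subset (k * N)} where

  ∈-projection₂ : ∀ x h → combine {k} {N} x h ∈ T → h ∈ projection₂ {k} T
  ∈-projection₂ x h xh∈T =
    lookup⇒[]= h _ (trans (lookup∘tabulate _ h)
                          (dec-true (any? λ y → combine {k} {N} y h ∈? T) (x , xh∈T)))

  projection₂-∈ : ∀ h → h ∈ projection₂ {k} T → ∃ λ x → combine {k} {N} x h ∈ T
  projection₂-∈ h h∈P =
    does-true⇒ (any? _) (trans (sym (lookup∘tabulate _ h)) ([]=⇒lookup h∈P))

  ∣projection₂∣≤ : ∣ projection₂ {k} T ∣ ≤ ∣ T ∣
  ∣projection₂∣≤ = begin
    ∣ projection₂ {k} T ∣
      ≡⟨ ∣S∣≡count-∈ (projection₂ {k} T) ⟩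
    count (_∈? projection₂ {k} T)
      ≤⟨ count-mono _ (λ h → any? (λ x → combine {k} {N} x h ∈? T)) projection₂-∈ ⟩
    count (λ h → any? (λ x → combine {k} {N} x h ∈? T))
      ≤⟨ count-∃-layer≤ {k} {N} (_∈? T) ⟩
    count (_∈? T)
      ≡⟨ sym (∣S∣≡count-∈ T) ⟩
    ∣ T ∣ ∎
    where open ≤-Reasoning

neighbours-in? : (G : Graph) (S : Subset (n G)) (v : Fin (n G)) →
  ∀ u → Dec (adj G v u ≡ true × u ∈ S)
neighbours-in? G S v u = Data.Bool._≟_ (adj G v u) true ×-dec (u ∈? S)

neighbours-out? : (G : Graph) (S : Subset (n G)) (v : Fin (n G)) →
  ∀ u → Dec (adj G v u ≡ true × u ∉ S)
neighbours-out? G S v u = Data.Bool._≟_ (adj G v u) true ×-dec ¬? (u ∈? S)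

∨-∧-true : ∀ a b c d → (a ∧ b) ∨ (c ∧ d) ≡ true → a ≡ true ⊎ d ≡ true
∨-∧-true true  _ _     _     _  = inj₁ refl
∨-∧-true false _ _     true  _  = inj₂ refl
∨-∧-true false _ true  false ()
∨-∧-true false _ false false ()

module _ (G H : Graph) where

  adj-□ : ∀ x h y h' →
    adj (G □ H) (combine x h) (combine y h') ≡ boxAdj' G H (x , h) (y , h')
  adj-□ x h y h' = cong₂ (boxAdj' G H) (remQuot-combine x h) (remQuot-combine y h')

  adj-□-layer : ∀ x h h' → adj (G □ H) (combine x h) (combine x h') ≡ adj H h h'
  adj-□-layer x h h' = begin
    adj (G □ H) (combine x h) (combine x h')
      ≡⟨ adj-□ x h x h' ⟩
    (does (x ≟ x) ∧ adj H h h') ∨ (adj G x x ∧ does (h ≟ h'))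
      ≡⟨ cong₂ (λ b c → (b ∧ adj H h h') ∨ (c ∧ does (h ≟ h')))
               (dec-true (x ≟ x) refl) (irref G x) ⟩
    adj H h h' ∨ false
      ≡⟨ ∨-identityʳ _ ⟩
    adj H h h' ∎
    where open ≡-Reasoning

  adj-□⇒same-layer⊎same-fibre : ∀ x h y h' →
    adj (G □ H) (combine x h) (combine y h') ≡ true → x ≡ y ⊎ h ≡ h'
  adj-□⇒same-layer⊎same-fibre x h y h' xh∼yh'
    with ∨-∧-true (does (x ≟ y)) _ _ (does (h ≟ h'))
                  (trans (sym (adj-□ x h y h')) xh∼yh')
  ... | inj₁ x≟y = inj₁ (does-true⇒ (x ≟ y) x≟y)
  ... | inj₂ h≟h' = inj₂ (does-true⇒ (h ≟ h') h≟h')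

module _ (G H : Graph) {T : Subset (n G * n H)} (x : Fin (n G)) (h : Fin (n H)) where

  private
    v : Fin (n G * n H)
    v = combine x h
    P : Subset (n H)
    P = projection₂ {n G} T

  δc-projection₂≤δc-□ : δc H P h ≤ δc (G □ H) T v
  δc-projection₂≤δc-□ =
    ≤-trans (count-mono (neighbours-out? H P h)
                        (λ h' → neighbours-out? (G □ H) T v (combine x h')) lift)
            (count-layer≤ {n G} {n H} (neighbours-out? (G □ H) T v) x)
    where
    lift : ∀ h' → adj H h h' ≡ true × h' ∉ P →
           adj (G □ H) v (combine x h') ≡ true × combine x h' ∉ T
    lift h' (h∼h' , h'∉P) =
      trans (adj-□-layer G H x h h') h∼h' , λ xh'∈T → h'∉P (∈-projection₂ x h' xh'∈T)

  δ-□≤δ-projection₂ : h ∉ P → δ (G □ H) T v ≤ δ H P h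
  δ-□≤δ-projection₂ h∉P =
    ≤-trans (count-within-layer {n G} {n H} (neighbours-in? (G □ H) T v) x onlyLayer)
            (count-mono (λ h' → neighbours-in? (G □ H) T v (combine x h'))
                        (neighbours-in? H P h) project)
    where
    onlyLayer : ∀ y h' → adj (G □ H) v (combine y h') ≡ true × combine y h' ∈ T → y ≡ x
    onlyLayer y h' (v∼yh' , yh'∈T) with adj-□⇒same-layer⊎same-fibre G H x h y h' v∼yh'
    ... | inj₁ x≡y = sym x≡y
    ... | inj₂ refl = ⊥-elim (h∉P (∈-projection₂ y h yh'∈T))
    project : ∀ h' → adj (G □ H) v (combine x h') ≡ true × combine x h' ∈ T →
              adj H h h' ≡ true × h' ∈ P
    project h' (v∼xh' , xh'∈T) =
      trans (sym (adj-□-layer G H x h h')) v∼xh' , ∈-projection₂ x h' xh'∈T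

projection₂-isGOA : (G H : Graph) (T : Subset (n G * n H)) →
  IsGOA (G □ H) T → IsGOA H (projection₂ {n G} T)
projection₂-isGOA G H T ((u , u∈T) , attacked) =
  (h₀ , ∈-projection₂ x₀ h₀ x₀h₀∈T) , attackedH
  where
  open ≤-Reasoning
  P = projection₂ {n G} T
  x₀ = proj₁ (remQuot {n G} (n H) u)
  h₀ = proj₂ (remQuot {n G} (n H) u)
  x₀h₀∈T : combine x₀ h₀ ∈ T
  x₀h₀∈T = subst (_∈ T) (sym (combine-remQuot {n G} (n H) u)) u∈T
  attackedH : ∀ h → h ∉ P → δc H P h + 1 ≤ δ H P h
  attackedH h h∉P = begin
    δc H P h + 1
      ≤⟨ +-monoˡ-≤ 1 (δc-projection₂≤δc-□ G H x₀ h) ⟩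
    δc (G □ H) T (combine x₀ h) + 1
      ≤⟨ attacked (combine x₀ h) (λ x₀h∈T → h∉P (∈-projection₂ x₀ h x₀h∈T)) ⟩
    δ (G □ H) T (combine x₀ h)
      ≤⟨ δ-□≤δ-projection₂ G H x₀ h h∉P ⟩
    δ H P h ∎

γo≤γo-□ : (G H : Graph) {b c : ℕ} → IsGammaO H b → IsGammaO (G □ H) c → b ≤ c
γo≤γo-□ G H {b} {c} (_ , minimal) ((T , T-isGOA , ∣T∣≡c) , _) = begin
  b                        ≤⟨ minimal _ (projection₂-isGOA G H T T-isGOA) ⟩
  ∣ projection₂ {n G} T ∣  ≤⟨ ∣projection₂∣≤ {n G} {n H} {T} ⟩
  ∣ T ∣                    ≡⟨ ∣T∣≡c ⟩
  c                        ∎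
  where open ≤-Reasoning

centre-isGOA : ∀ m → IsGOA (star m) ⁅ zero ⁆
centre-isGOA m = (zero , x∈⁅x⁆ zero) , leafAttacked
  where
  leafAttacked : ∀ v → v ∉ ⁅ zero ⁆ →
                 δc (star m) ⁅ zero ⁆ v + 1 ≤ δ (star m) ⁅ zero ⁆ v
  leafAttacked zero    v∉S = ⊥-elim (v∉S (x∈⁅x⁆ zero))
  -- δ of a leaf computes to 1 + ⋯, the centre being vertex zero.
  leafAttacked (suc i) _   =
    ≤-trans (≤-reflexive (cong (_+ 1) (count-none (neighbours-out? (star m) ⁅ zero ⁆ (suc i))
                                                  onlyCentre)))
            (s≤s z≤n)
    where
    onlyCentre : ∀ u → ¬ (starAdj (suc i) u ≡ true × u ∉ ⁅ zero ⁆)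
    onlyCentre zero    (_ , 0∉S) = 0∉S (x∈⁅x⁆ zero)
    onlyCentre (suc u) (() , _)

γo-star≤1 : ∀ m {a} → IsGammaO (star m) a → a ≤ 1
γo-star≤1 m (_ , minimal) =
  ≤-trans (minimal ⁅ zero ⁆ (centre-isGOA m)) (≤-reflexive (∣⁅x⁆∣≡1 {suc m} zero))

corollary3 : (m : ℕ) → 1 ≤ m → (H : Graph) → (a b c : ℕ) →
    IsGammaO (star m) a → IsGammaO H b → IsGammaO (star m □ H) c →
    c ≥ a * b
corollary3 m _ H a b c γ-star γ-H γ-□ = begin
  a * b  ≤⟨ *-monoˡ-≤ b (γo-star≤1 m γ-star) ⟩
  1 * b  ≡⟨ *-identityˡ b ⟩
  b      ≤⟨ γo≤γo-□ (star m) H γ-H γ-□ ⟩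
  c      ∎
  where open ≤-Reasoning
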